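{- For every integer $r \geq 4$, there is no $(r \times (r(r-1)-1),\ r(r-1)+1)$-near triple array.
   Context: An $r\times c$ row-column design on $v$ symbols is an $r\times c$ array each of whose cells is filled with one of $v$ symbols. It is binary if no symbol occurs more than once in any row or in any column. Let $e=rc/v$, $e^-=\lfloor e\rfloor$, $e^+=\lceil e\rceil$. The design is equireplicate if $e$ is an integer and every symbol occurs exactly $e$ times, and near equireplicate if $e$ is not an integer and every symbol occurs $e^-$ or $e^+$ times. For a binary design, let $R_i$, $C_j$ be the symbol sets of row $i$ and column $j$, and put $\lambda_{rc}=\frac{1}{rc}\sum_{i,j}|R_i\cap C_j|$, $\lambda_{rr}=\binom{r}{2}^{ -1}\sum_{i<j}|R_i\cap R_j|$, $\lambda_{cc}=\binom{c}{2}^{ -1}\sum_{i<j}|C_i\cap C_j|$; for real $x$, $x^-=\lfloor x\rfloor$, $x^+=\lceil x\rceil$. An $(r\times c,v)$-near triple array is a binary $r\times c$ row-column design on $v$ symbols which is equireplicate or near equireplicate and in which every row and column share $\lambda_{rc}^-$ or $\lambda_{rc}^+$ symbols, every two distinct rows share $\lambda_{rr}^-$ or $\lambda_{rr}^+$ symbols, and every two distinct columns share $\lambda_{cc}^-$ or $\lambda_{cc}^+$ symbols. -}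

module Defs where

open import Data.Nat using (ℕ; zero; suc; _+_; _*_; _∸_; _<ᵇ_; _/_)
open import Data.Bool using (Bool; if_then_else_)
open import Data.Fin using (Fin; toℕ; _≟_; _<_) renaming (zero to fzero; suc to fsuc)
open import Data.Fin.Subset using (Subset; _∩_; ∣_∣)
open import Data.Fin.Properties using (any?)
open import Data.Vec using (tabulate)
open import Data.Product using (_×_)
open import Data.Sum using (_⊎_)
open import Function.Definitions using (Injective)
open import Relation.Nullary using (does)
open import Relation.Binary.PropositionalEquality using (_≡_)

Design : ℕ → ℕ → ℕ → Set
Design r c v = Fin r → Fin c → Fin v

Σ : ∀ {n} → (Fin n → ℕ) → ℕ
Σ {zero}  f = 0
Σ {suc n} f = f fzero + Σ (λ i → f (fsuc i))

Σ< : ∀ {n} → (Fin n → Fin n → ℕ) → ℕ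
Σ< f = Σ λ i → Σ λ j → if toℕ i <ᵇ toℕ j then f i j else 0

-- floor and ceiling of a / b for natural numbers (b = 0 gives 0; never used
-- in a non-vacuous way).
⌊_/_⌋ : ℕ → ℕ → ℕ
⌊ a / zero ⌋  = 0
⌊ a / suc b ⌋ = a / suc b

⌈_/_⌉ : ℕ → ℕ → ℕ
⌈ a / zero ⌉  = 0
⌈ a / suc b ⌉ = (a + b) / suc b

FloorOrCeil : ℕ → ℕ → ℕ → Set
FloorOrCeil x a b = x ≡ ⌊ a / b ⌋ ⊎ x ≡ ⌈ a / b ⌉

module _ {r c v : ℕ} (D : Design r c v) where

  rowSet : Fin r → Subset v
  rowSet i = tabulate λ s → does (any? λ j → D i j ≟ s)

  colSet : Fin c → Subset v
  colSet j = tabulate λ s → does (any? λ i → D i j ≟ s)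

  Binary : Set
  Binary = (∀ i → Injective _≡_ _≡_ (λ j → D i j))
         × (∀ j → Injective _≡_ _≡_ (λ i → D i j))

  occ : Fin v → ℕ
  occ s = Σ λ i → Σ λ j → if does (D i j ≟ s) then 1 else 0

  -- equireplicate (e = rc/v integer, all occur e times) or near
  -- equireplicate (all occur ⌊e⌋ or ⌈e⌉ times); both say: every symbol
  -- occurs ⌊rc/v⌋ or ⌈rc/v⌉ times.
  EquiOrNearEqui : Set
  EquiOrNearEqui = ∀ s → FloorOrCeil (occ s) (r * c) v

  rc-total rr-total cc-total : ℕ
  rc-total = Σ λ i → Σ λ j → ∣ rowSet i ∩ colSet j ∣
  rr-total = Σ< λ i i' → ∣ rowSet i ∩ rowSet i' ∣
  cc-total = Σ< λ j j' → ∣ colSet j ∩ colSet j' ∣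

  pairs : ℕ → ℕ
  pairs n = (n * (n ∸ 1)) / 2

  IsNearTripleArray : Set
  IsNearTripleArray =
      Binary
    × EquiOrNearEqui
    × (∀ i j → FloorOrCeil ∣ rowSet i ∩ colSet j ∣ rc-total (r * c))
    × (∀ i i' → i < i' →
         FloorOrCeil ∣ rowSet i ∩ rowSet i' ∣ rr-total (pairs r))
    × (∀ j j' → j < j' →
         FloorOrCeil ∣ colSet j ∩ colSet j' ∣ cc-total (pairs c))

{-# OPTIONS --safe #-}
module Submission where

-- Write r = q + 1 and read the c = rq − 1 columns as lines of size r
-- on the v = c + 2 symbols; by near-equireplication every symbol lies on q or r lines. Double
-- counting Σ deg² shows that the column intersections add up to exactly C(c,2) − 1, so distinct
-- columns share at most one symbol, and the deficits from "every two columns meet once" add up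
-- to 2 over ordered pairs; in particular some two columns j, j′ are disjoint.
-- A symbol on r lines sees r·q = v − 1 other symbols, so it is joined to every other symbol
-- exactly once. Such a symbol cannot lie on j: its r − 1 lines other than j would have to reach
-- all r symbols of j′. Hence every symbol of j lies on q lines, so the r symbols of j have degrees
-- summing to rq, and j meets the other c − 1 columns in only rq − r = c − q symbols altogether:
-- the deficit at j is q − 1, and likewise at j′. Thus 2(q − 1) ≤ 2, that is r ≤ 3.

open import Data.Bool using (Bool; true; false; if_then_else_)
open import Data.Empty using (⊥-elim)
open import Data.Fin using (Fin; toℕ; _≟_)
  renaming (zero to fzero; suc to fsuc; _<_ to _<ᶠ_)
open import Data.Fin.Properties using (¬∀⟶∃¬; <-cmp; any?)
  renaming (suc-injective to fsuc-injective)
open import Data.Fin.Subset using (Subset; _∩_; ∣_∣)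
open import Data.Nat
  using (ℕ; zero; suc; _+_; _*_; _∸_; _/_; _<ᵇ_; _≤_; _<_; _≥_; z≤n; s≤s; s≤s⁻¹; z<s;
         NonZero; >-nonZero)
  renaming (_≟_ to _≟ℕ_)
open import Data.Nat.Divisibility using (n∣m*n)
open import Data.Nat.DivMod using (m<n⇒m/n≡0; m<n*o⇒m/o<n; m*n/n≡m; +-distrib-/-∣ˡ)
open import Data.Nat.Properties
  using (≤-refl; ≤-trans; ≤-antisym; ≤-reflexive; <⇒≤; <⇒≱; <-≤-trans; 1+n≰n; n<1+n;
         n≤0⇒n≡0; n<1⇒n≡0; n≤1⇒n≡0∨n≡1; m<m+n; m+n≤o⇒n≤o; +-mono-≤; +-monoˡ-≤; +-monoʳ-≤;
         +-cancelˡ-≤; +-cancelʳ-≤; +-cancelʳ-≡; +-comm; +-suc; +-identityʳ; *-comm; *-zeroʳ;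
         *-identityʳ; *-mono-≤; m*n≡0⇒m≡0∨n≡0; m*n≡1⇒m≡1; m*n≡1⇒n≡1; m*n≢0; m∸n+n≡m;
         m∸n≢0⇒n<m; n∸n≡0; suc-injective; suc-pred; +-*-semiring; module ≤-Reasoning)
open import Data.Nat.Tactic.RingSolver using (solve-∀)
open import Data.Product using (∃; ∃₂; _×_; _,_; proj₁; proj₂)
open import Data.Sum using (_⊎_; inj₁; inj₂)
open import Data.Vec using ([]; _∷_; lookup)
open import Data.Vec.Properties using (lookup∘tabulate)
open import Function using (_∘_; case_of_; flip)
open import Function.Definitions using (Injective)
open import Relation.Binary.Definitions using (tri<; tri≈; tri>)
open import Relation.Binary.PropositionalEquality
open import Relation.Nullary using (¬_; does; yes; no)

open import Algebra.Properties.Semiring.Sum +-*-semiring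
  using (sum; sum-cong-≗; ∑-distrib-+; ∑-comm; *-distribˡ-sum; *-distribʳ-sum)

open import Defs

Σ≡sum : ∀ {n} (f : Fin n → ℕ) → Σ f ≡ sum f
Σ≡sum {zero}  f = refl
Σ≡sum {suc n} f = cong (f fzero +_) (Σ≡sum (f ∘ fsuc))

Σ-cong : ∀ {n} {f g : Fin n → ℕ} → (∀ i → f i ≡ g i) → Σ f ≡ Σ g
Σ-cong {f = f} {g} f≗g = trans (Σ≡sum f) (trans (sum-cong-≗ f≗g) (sym (Σ≡sum g)))

Σ-distrib-+ : ∀ {n} (f g : Fin n → ℕ) → Σ (λ i → f i + g i) ≡ Σ f + Σ g
Σ-distrib-+ f g = begin
  Σ (λ i → f i + g i)     ≡⟨ Σ≡sum (λ i → f i + g i) ⟩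
  sum (λ i → f i + g i)   ≡⟨ ∑-distrib-+ f g ⟩
  sum f + sum g           ≡⟨ sym (cong₂ _+_ (Σ≡sum f) (Σ≡sum g)) ⟩
  Σ f + Σ g               ∎
  where open ≡-Reasoning

*-distribˡ-Σ : ∀ {n} x (f : Fin n → ℕ) → x * Σ f ≡ Σ (λ i → x * f i)
*-distribˡ-Σ x f = begin
  x * Σ f               ≡⟨ cong (x *_) (Σ≡sum f) ⟩
  x * sum f             ≡⟨ *-distribˡ-sum x f ⟩
  sum (λ i → x * f i)   ≡⟨ sym (Σ≡sum (λ i → x * f i)) ⟩
  Σ (λ i → x * f i)     ∎
  where open ≡-Reasoning

*-distribʳ-Σ : ∀ {n} x (f : Fin n → ℕ) → Σ f * x ≡ Σ (λ i → f i * x)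
*-distribʳ-Σ x f = begin
  Σ f * x               ≡⟨ cong (_* x) (Σ≡sum f) ⟩
  sum f * x             ≡⟨ *-distribʳ-sum x f ⟩
  sum (λ i → f i * x)   ≡⟨ sym (Σ≡sum (λ i → f i * x)) ⟩
  Σ (λ i → f i * x)     ∎
  where open ≡-Reasoning

Σ-comm : ∀ {m n} (f : Fin m → Fin n → ℕ) → Σ (λ i → Σ (f i)) ≡ Σ (λ j → Σ (λ i → f i j))
Σ-comm f = begin
  Σ (λ i → Σ (f i))               ≡⟨ Σ-cong (λ i → Σ≡sum (f i)) ⟩
  Σ (λ i → sum (f i))             ≡⟨ Σ≡sum (λ i → sum (f i)) ⟩
  sum (λ i → sum (f i))           ≡⟨ ∑-comm f ⟩
  sum (λ j → sum (λ i → f i j))   ≡⟨ sym (Σ≡sum (λ j → sum (λ i → f i j))) ⟩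
  Σ (λ j → sum (λ i → f i j))     ≡⟨ sym (Σ-cong (λ j → Σ≡sum (λ i → f i j))) ⟩
  Σ (λ j → Σ (λ i → f i j))       ∎
  where open ≡-Reasoning

Σ-const : ∀ {n} x → Σ {n} (λ _ → x) ≡ n * x
Σ-const {zero}  x = refl
Σ-const {suc n} x = cong (x +_) (Σ-const {n} x)

Σ-zero : ∀ {n} (f : Fin n → ℕ) → (∀ i → f i ≡ 0) → Σ f ≡ 0
Σ-zero {n} f f≗0 = trans (Σ-cong f≗0) (trans (Σ-const {n} 0) (*-zeroʳ n))

Σ≢0⇒∃≢0 : ∀ {n} (f : Fin n → ℕ) → Σ f ≢ 0 → ∃ λ i → f i ≢ 0
Σ≢0⇒∃≢0 {n} f Σf≢0 = ¬∀⟶∃¬ n (λ i → f i ≡ 0) (λ i → f i ≟ℕ 0) (Σf≢0 ∘ Σ-zero f)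

Σ-mono-≤ : ∀ {n} {f g : Fin n → ℕ} → (∀ i → f i ≤ g i) → Σ f ≤ Σ g
Σ-mono-≤ {zero}  f≤g = z≤n
Σ-mono-≤ {suc n} f≤g = +-mono-≤ (f≤g fzero) (Σ-mono-≤ (f≤g ∘ fsuc))

Σ-tight : ∀ {n} {f g : Fin n → ℕ} → (∀ i → f i ≤ g i) → Σ g ≤ Σ f → ∀ i → f i ≡ g i
Σ-tight {suc n} {f} {g} f≤g Σg≤Σf fzero = ≤-antisym (f≤g fzero)
  (+-cancelʳ-≤ _ _ _ (≤-trans (+-monoʳ-≤ (g fzero) (Σ-mono-≤ (f≤g ∘ fsuc))) Σg≤Σf))
Σ-tight {suc n} {f} {g} f≤g Σg≤Σf (fsuc i) = Σ-tight (f≤g ∘ fsuc)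
  (+-cancelˡ-≤ _ _ _ (≤-trans (+-monoˡ-≤ _ (f≤g fzero)) Σg≤Σf)) i

select : ∀ {n} → Fin n → (Fin n → ℕ) → Fin n → ℕ
select i f j = if does (i ≟ j) then f j else 0

Σ-select : ∀ {n} (i : Fin n) (f : Fin n → ℕ) → Σ (select i f) ≡ f i
Σ-select {suc n} fzero    f = trans (cong (f fzero +_) (Σ-zero {n} (λ _ → 0) (λ _ → refl)))
                                    (+-identityʳ (f fzero))
Σ-select {suc n} (fsuc i) f = Σ-select i (f ∘ fsuc)

f[i]≤Σf : ∀ {n} (f : Fin n → ℕ) i → f i ≤ Σ f
f[i]≤Σf f i = subst (_≤ Σ f) (Σ-select i f) (Σ-mono-≤ select≤)
  where
  select≤ : ∀ k → select i f k ≤ f k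
  select≤ k with i ≟ k
  ... | yes _ = ≤-refl
  ... | no _  = z≤n

f[i]+f[j]≤Σf : ∀ {n} (f : Fin n → ℕ) {i j} → i ≢ j → f i + f j ≤ Σ f
f[i]+f[j]≤Σf f {i} {j} i≢j = begin
  f i + f j                               ≡⟨ sym (cong₂ _+_ (Σ-select i f) (Σ-select j f)) ⟩
  Σ (select i f) + Σ (select j f)         ≡⟨ sym (Σ-distrib-+ (select i f) (select j f)) ⟩
  Σ (λ k → select i f k + select j f k)   ≤⟨ Σ-mono-≤ selects≤ ⟩
  Σ f                                     ∎
  where
  open ≤-Reasoning
  selects≤ : ∀ k → select i f k + select j f k ≤ f k
  selects≤ k with i ≟ k | j ≟ k
  ... | yes refl | yes refl = ⊥-elim (i≢j refl)
  ... | yes _    | no _     = ≤-reflexive (+-identityʳ (f k))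
  ... | no _     | yes _    = ≤-refl
  ... | no _     | no _     = z≤n

Σ≤1 : ∀ {n} {f : Fin n → ℕ} → (∀ i → f i ≤ 1) → (∀ i j → f i ≡ 1 → f j ≡ 1 → i ≡ j) → Σ f ≤ 1
Σ≤1 {zero}      _   _      = z≤n
Σ≤1 {suc n} {f} f≤1 unique with n≤1⇒n≡0∨n≡1 (f≤1 fzero)
... | inj₁ f₀≡0 rewrite f₀≡0 =
  Σ≤1 (f≤1 ∘ fsuc) (λ i j fᵢ≡1 fⱼ≡1 → fsuc-injective (unique _ _ fᵢ≡1 fⱼ≡1))
... | inj₂ f₀≡1 rewrite f₀≡1 = ≤-reflexive (cong suc (Σ-zero (f ∘ fsuc) rest≡0))
  where
  rest≡0 : ∀ i → f (fsuc i) ≡ 0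
  rest≡0 i with n≤1⇒n≡0∨n≡1 (f≤1 (fsuc i))
  ... | inj₁ fᵢ≡0 = fᵢ≡0
  ... | inj₂ fᵢ≡1 = case unique _ _ f₀≡1 fᵢ≡1 of λ ()

Σ-square-two-valued : ∀ {n} a b (f : Fin n → ℕ) → (∀ i → f i ≡ a ⊎ f i ≡ b) →
                      Σ (λ i → f i * f i) + n * (a * b) ≡ (a + b) * Σ f
Σ-square-two-valued {n} a b f f≡a⊎b = begin
  Σ (λ i → f i * f i) + n * (a * b)           ≡⟨ cong (Σ (λ i → f i * f i) +_) (sym (Σ-const {n} (a * b))) ⟩
  Σ (λ i → f i * f i) + Σ {n} (λ _ → a * b)   ≡⟨ sym (Σ-distrib-+ {n} (λ i → f i * f i) (λ _ → a * b)) ⟩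
  Σ (λ i → f i * f i + a * b)                 ≡⟨ Σ-cong square+ab ⟩
  Σ (λ i → (a + b) * f i)                     ≡⟨ sym (*-distribˡ-Σ (a + b) f) ⟩
  (a + b) * Σ f                               ∎
  where
  open ≡-Reasoning
  aa+ab≡[a+b]a : ∀ a b → a * a + a * b ≡ (a + b) * a
  aa+ab≡[a+b]a = solve-∀
  bb+ab≡[a+b]b : ∀ a b → b * b + a * b ≡ (a + b) * b
  bb+ab≡[a+b]b = solve-∀
  square+ab : ∀ i → f i * f i + a * b ≡ (a + b) * f i
  square+ab i with f≡a⊎b i
  ... | inj₁ fᵢ≡a rewrite fᵢ≡a = aa+ab≡[a+b]a a b
  ... | inj₂ fᵢ≡b rewrite fᵢ≡b = bb+ab≡[a+b]b a b

2*Σ<+trace≡ΣΣ : ∀ {n} (F : Fin n → Fin n → ℕ) → (∀ i j → F i j ≡ F j i) →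
                2 * Σ< F + Σ (λ i → F i i) ≡ Σ (λ i → Σ (F i))
2*Σ<+trace≡ΣΣ {zero}  F F-sym = refl
2*Σ<+trace≡ΣΣ {suc n} F F-sym = begin
  2 * (R + Σ< F′) + (F fzero fzero + Σ (λ i → F′ i i))
    ≡⟨ rearrange (F fzero fzero) R (Σ< F′) (Σ (λ i → F′ i i)) ⟩
  (F fzero fzero + R) + (R + (2 * Σ< F′ + Σ (λ i → F′ i i)))
    ≡⟨ cong₂ (λ x y → (F fzero fzero + R) + (x + y))
             (Σ-cong (λ j → F-sym fzero (fsuc j)))
             (2*Σ<+trace≡ΣΣ F′ (λ i j → F-sym (fsuc i) (fsuc j))) ⟩
  (F fzero fzero + R) + (Σ (λ i → F (fsuc i) fzero) + Σ (λ i → Σ (F′ i)))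
    ≡⟨ cong ((F fzero fzero + R) +_) (sym (Σ-distrib-+ (λ i → F (fsuc i) fzero) (λ i → Σ (F′ i)))) ⟩
  Σ (λ i → Σ (F i))
    ∎
  where
  open ≡-Reasoning
  R : ℕ
  R = Σ (λ j → F fzero (fsuc j))
  F′ : Fin n → Fin n → ℕ
  F′ i j = F (fsuc i) (fsuc j)
  rearrange : ∀ a r s d → 2 * (r + s) + (a + d) ≡ (a + r) + (r + (2 * s + d))
  rearrange = solve-∀

-- Row i of the intersection matrix of a linear space with lines of size 1 + q is bounded by
-- spike q i.
spike : ∀ {n} → ℕ → Fin n → Fin n → ℕ
spike q i j = suc (select i (λ _ → q) j)

spike-self : ∀ {n} q (i : Fin n) → spike q i i ≡ suc q
spike-self q i with i ≟ i
... | yes _  = refl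
... | no i≢i = ⊥-elim (i≢i refl)

spike-off : ∀ {n} q {i j : Fin n} → i ≢ j → spike q i j ≡ 1
spike-off q {i} {j} i≢j with i ≟ j
... | yes i≡j = ⊥-elim (i≢j i≡j)
... | no _    = refl

Σ-spike : ∀ {n} q (i : Fin n) → Σ (spike q i) ≡ n + q
Σ-spike {n} q i = begin
  Σ (λ j → 1 + select i (λ _ → q) j)         ≡⟨ Σ-distrib-+ (λ _ → 1) (select i (λ _ → q)) ⟩
  Σ {n} (λ _ → 1) + Σ (select i (λ _ → q))   ≡⟨ cong₂ _+_ (trans (Σ-const {n} 1) (*-identityʳ n))
                                                            (Σ-select i (λ _ → q)) ⟩
  n + q                                      ∎
  where open ≡-Reasoning

≤spike : ∀ {n q} {i : Fin n} {g : Fin n → ℕ} → g i ≤ suc q → (∀ j → i ≢ j → g j ≤ 1) →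
         ∀ j → g j ≤ spike q i j
≤spike {i = i} gᵢ≤1+q off j with i ≟ j
... | yes refl = gᵢ≤1+q
... | no i≢j   = off j i≢j

degree : ∀ {v c} → (Fin v → Fin c → ℕ) → Fin v → ℕ
degree I z = Σ (I z)

common : ∀ {v c} → (Fin v → Fin c → ℕ) → Fin c → Fin c → ℕ
common I j j′ = Σ λ z → I z j * I z j′

module _ {v c : ℕ} (I : Fin v → Fin c → ℕ) where

  common-sym : ∀ j j′ → common I j j′ ≡ common I j′ j
  common-sym j j′ = Σ-cong (λ z → *-comm (I z j) (I z j′))

  Σ-common : ∀ j → Σ (common I j) ≡ Σ (λ z → I z j * degree I z)
  Σ-common j = begin
    Σ (λ L → Σ (λ z → I z j * I z L))   ≡⟨ Σ-comm (λ L z → I z j * I z L) ⟩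
    Σ (λ z → Σ (λ L → I z j * I z L))   ≡⟨ Σ-cong (λ z → sym (*-distribˡ-Σ (I z j) (I z))) ⟩
    Σ (λ z → I z j * degree I z)        ∎
    where open ≡-Reasoning

  ΣΣ-common : Σ (λ j → Σ (common I j)) ≡ Σ (λ z → degree I z * degree I z)
  ΣΣ-common = begin
    Σ (λ j → Σ (common I j))                 ≡⟨ Σ-cong Σ-common ⟩
    Σ (λ j → Σ (λ z → I z j * degree I z))   ≡⟨ Σ-comm (λ j z → I z j * degree I z) ⟩
    Σ (λ z → Σ (λ j → I z j * degree I z))   ≡⟨ Σ-cong (λ z → sym (*-distribʳ-Σ (degree I z) (I z))) ⟩
    Σ (λ z → degree I z * degree I z)        ∎
    where open ≡-Reasoning

  Σ-common-through : ∀ s j → Σ (λ L → I s L * common I L j) ≡ Σ (λ z → I z j * common (flip I) s z)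
  Σ-common-through s j = begin
    Σ (λ L → I s L * Σ (λ z → I z L * I z j))
      ≡⟨ Σ-cong (λ L → *-distribˡ-Σ (I s L) (λ z → I z L * I z j)) ⟩
    Σ (λ L → Σ (λ z → I s L * (I z L * I z j)))
      ≡⟨ Σ-comm (λ L z → I s L * (I z L * I z j)) ⟩
    Σ (λ z → Σ (λ L → I s L * (I z L * I z j)))
      ≡⟨ Σ-cong (λ z → Σ-cong (λ L → rearrange (I s L) (I z L) (I z j))) ⟩
    Σ (λ z → Σ (λ L → I z j * (I s L * I z L)))
      ≡⟨ Σ-cong (λ z → sym (*-distribˡ-Σ (I z j) (λ L → I s L * I z L))) ⟩
    Σ (λ z → I z j * common (flip I) s z)
      ∎
    where
    open ≡-Reasoning
    rearrange : ∀ a b d → a * (b * d) ≡ d * (a * b)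
    rearrange = solve-∀

  module _ (I≤1 : ∀ z j → I z j ≤ 1) where

    common-self : ∀ j → common I j j ≡ Σ (λ z → I z j)
    common-self j = Σ-cong (λ z → idempotent (I≤1 z j))
      where
      idempotent : ∀ {x} → x ≤ 1 → x * x ≡ x
      idempotent z≤n       = refl
      idempotent (s≤s z≤n) = refl

    dual-common≤1 : (∀ j j′ → j ≢ j′ → common I j j′ ≤ 1) → ∀ s w → s ≢ w → common (flip I) s w ≤ 1
    dual-common≤1 common≤1 s w s≢w = Σ≤1 (λ j → *-mono-≤ (I≤1 s j) (I≤1 w j)) unique
      where
      unique : ∀ j j′ → I s j * I w j ≡ 1 → I s j′ * I w j′ ≡ 1 → j ≡ j′
      unique j j′ sw∈j sw∈j′ with j ≟ j′
      ... | yes j≡j′ = j≡j′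
      ... | no j≢j′  = case ≤-trans two≤common (common≤1 j j′ j≢j′) of λ { (s≤s ()) }
        where
        two≤common : 2 ≤ common I j j′
        two≤common = subst (_≤ common I j j′)
          (cong₂ _+_ (cong₂ _*_ (m*n≡1⇒m≡1 (I s j) (I w j) sw∈j) (m*n≡1⇒m≡1 (I s j′) (I w j′) sw∈j′))
                     (cong₂ _*_ (m*n≡1⇒n≡1 (I s j) (I w j) sw∈j) (m*n≡1⇒n≡1 (I s j′) (I w j′) sw∈j′)))
          (f[i]+f[j]≤Σf (λ z → I z j * I z j′) s≢w)

FloorOrCeil-n/1+n⇒≤1 : ∀ {x n} → FloorOrCeil x n (suc n) → x ≤ 1
FloorOrCeil-n/1+n⇒≤1 {n = n} (inj₁ refl) = ≤-trans (≤-reflexive (m<n⇒m/n≡0 (n<1+n n))) z≤n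
FloorOrCeil-n/1+n⇒≤1 {n = n} (inj₂ refl) = s≤s⁻¹ (m<n*o⇒m/o<n {n + n} {2} {suc n} n+n<2[1+n])
  where
  n+n+2≡2[1+n] : ∀ n → n + n + 2 ≡ 2 * suc n
  n+n+2≡2[1+n] = solve-∀
  n+n<2[1+n] : n + n < 2 * suc n
  n+n<2[1+n] = subst (n + n <_) (n+n+2≡2[1+n] n) (m<m+n (n + n) {2} z<s)

FloorOrCeil⇒≡⊎≡ : ∀ {x a b m n} → FloorOrCeil x a b → ⌊ a / b ⌋ ≡ m → ⌈ a / b ⌉ ≡ n → x ≡ m ⊎ x ≡ n
FloorOrCeil⇒≡⊎≡ (inj₁ x≡⌊⌋) ⌊⌋≡m _    = inj₁ (trans x≡⌊⌋ ⌊⌋≡m)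
FloorOrCeil⇒≡⊎≡ (inj₂ x≡⌈⌉) _    ⌈⌉≡n = inj₂ (trans x≡⌈⌉ ⌈⌉≡n)

[m*n+k]/n≡m : ∀ m {n k} .{{_ : NonZero n}} → k < n → (m * n + k) / n ≡ m
[m*n+k]/n≡m m {n} {k} k<n = begin
  (m * n + k) / n     ≡⟨ +-distrib-/-∣ˡ k (n∣m*n m) ⟩
  m * n / n + k / n   ≡⟨ cong₂ _+_ (m*n/n≡m m n) (m<n⇒m/n≡0 k<n) ⟩
  m + 0               ≡⟨ +-identityʳ m ⟩
  m                   ∎
  where open ≡-Reasoning

-- With q = 2 + t the numbers c and v become polynomials in t.
replication-number : ∀ q {c v} → 2 ≤ q → suc c ≡ suc q * q → v ≡ 2 + c →
                     ⌊ suc q * c / v ⌋ ≡ q × ⌈ suc q * c / v ⌉ ≡ suc q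
replication-number (suc (suc t)) {c} (s≤s (s≤s z≤n)) 1+c≡[1+q]q refl =
  subst (λ x → ⌊ (3 + t) * x / (2 + x) ⌋ ≡ 2 + t × ⌈ (3 + t) * x / (2 + x) ⌉ ≡ 3 + t)
        (sym (suc-injective (trans 1+c≡[1+q]q (c-poly t))))
        (floor , ceil)
  where
  c-poly : ∀ t → (3 + t) * (2 + t) ≡ suc (5 + (5 * t + t * t))
  c-poly = solve-∀
  floor-split : ∀ t → (3 + t) * (5 + (5 * t + t * t))
                      ≡ (2 + t) * (2 + (5 + (5 * t + t * t))) + (1 + (3 * t + t * t))
  floor-split = solve-∀
  floor-gap : ∀ t → (1 + (3 * t + t * t)) + suc (5 + 2 * t) ≡ 2 + (5 + (5 * t + t * t))
  floor-gap = solve-∀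
  ceil-split : ∀ t → (3 + t) * (5 + (5 * t + t * t)) + (1 + (5 + (5 * t + t * t)))
                     ≡ (3 + t) * (2 + (5 + (5 * t + t * t))) + (3 * t + t * t)
  ceil-split = solve-∀
  ceil-gap : ∀ t → (3 * t + t * t) + suc (6 + 2 * t) ≡ 2 + (5 + (5 * t + t * t))
  ceil-gap = solve-∀
  P : ℕ
  P = 5 + (5 * t + t * t)
  floor : ⌊ (3 + t) * P / (2 + P) ⌋ ≡ 2 + t
  floor = trans (cong (_/ (2 + P)) (floor-split t))
                ([m*n+k]/n≡m (2 + t) (subst (1 + (3 * t + t * t) <_) (floor-gap t) (m<m+n _ z<s)))
  ceil : ⌈ (3 + t) * P / (2 + P) ⌉ ≡ 3 + t
  ceil = trans (cong (_/ (2 + P)) (ceil-split t))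
               ([m*n+k]/n≡m (3 + t) (subst (3 * t + t * t <_) (ceil-gap t) (m<m+n _ z<s)))

module ColumnSystem
  (q : ℕ) {v c : ℕ} (1+c≡[1+q]q : suc c ≡ suc q * q) (v≡2+c : v ≡ 2 + c)
  (I : Fin v → Fin c → ℕ) (I≤1 : ∀ z j → I z j ≤ 1)
  (column-size : ∀ j → Σ (λ z → I z j) ≡ suc q)
  (degree≡q⊎1+q : ∀ z → degree I z ≡ q ⊎ degree I z ≡ suc q)
  (meet-balanced : ∀ j j′ → j <ᶠ j′ →
                   FloorOrCeil (common I j j′) (Σ< (common I)) (c * (c ∸ 1) / 2))
  where

  meet : Fin c → Fin c → ℕ
  meet = common I

  concurrence : Fin v → Fin v → ℕ
  concurrence = common (flip I)

  ΣΣmeet : ℕ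
  ΣΣmeet = Σ (λ j → Σ (meet j))

  meet-self : ∀ j → meet j j ≡ suc q
  meet-self j = trans (common-self I I≤1 j) (column-size j)

  ΣΣmeet+2≡c[c+q] : ΣΣmeet + 2 ≡ c * (c + q)
  ΣΣmeet+2≡c[c+q] = +-cancelʳ-≡ ((2 + c) * suc c) _ _ (begin
    ΣΣmeet + 2 + (2 + c) * suc c
      ≡⟨ shuffle ΣΣmeet 2 ((2 + c) * suc c) ⟩
    ΣΣmeet + (2 + c) * suc c + 2
      ≡⟨ cong (λ x → ΣΣmeet + x + 2) (sym (cong₂ _*_ v≡2+c q[1+q]≡1+c)) ⟩
    ΣΣmeet + v * (q * suc q) + 2
      ≡⟨ cong (λ x → x + v * (q * suc q) + 2) (ΣΣ-common I) ⟩
    Σ (λ z → degree I z * degree I z) + v * (q * suc q) + 2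
      ≡⟨ cong (_+ 2) (Σ-square-two-valued q (suc q) (degree I) degree≡q⊎1+q) ⟩
    (q + suc q) * Σ (degree I) + 2
      ≡⟨ cong (λ x → (q + suc q) * x + 2) Σdegree≡c[1+q] ⟩
    (q + suc q) * (c * suc q) + 2
      ≡⟨ expand q c ⟩
    c * (2 * (q * suc q)) + c * suc q + 2
      ≡⟨ cong (λ x → c * (2 * x) + c * suc q + 2) q[1+q]≡1+c ⟩
    c * (2 * suc c) + c * suc q + 2
      ≡⟨ regroup q c ⟩
    c * (c + q) + (2 + c) * suc c
      ∎)
    where
    open ≡-Reasoning
    q[1+q]≡1+c : q * suc q ≡ suc c
    q[1+q]≡1+c = trans (*-comm q (suc q)) (sym 1+c≡[1+q]q)
    Σdegree≡c[1+q] : Σ (degree I) ≡ c * suc q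
    Σdegree≡c[1+q] = trans (Σ-comm I) (trans (Σ-cong column-size) (Σ-const {c} (suc q)))
    shuffle : ∀ x y z → x + y + z ≡ x + z + y
    shuffle = solve-∀
    expand : ∀ q c → (q + suc q) * (c * suc q) + 2 ≡ c * (2 * (q * suc q)) + c * suc q + 2
    expand = solve-∀
    regroup : ∀ q c → c * (2 * suc c) + c * suc q + 2 ≡ c * (c + q) + (2 + c) * suc c
    regroup = solve-∀

  pairs≡1+Σ<meet : c * (c ∸ 1) / 2 ≡ suc (Σ< meet)
  pairs≡1+Σ<meet = trans (cong (_/ 2) (pairs-count (Σ< meet) c 2Σ<meet+c[1+q]+2≡c[c+q]))
                         (m*n/n≡m (suc (Σ< meet)) 2)
    where
    2Σ<meet+c[1+q]+2≡c[c+q] : 2 * Σ< meet + c * suc q + 2 ≡ c * (c + q)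
    2Σ<meet+c[1+q]+2≡c[c+q] =
      trans (cong (λ x → 2 * Σ< meet + x + 2) (sym (trans (Σ-cong meet-self) (Σ-const {c} (suc q)))))
            (trans (cong (_+ 2) (2*Σ<+trace≡ΣΣ meet (common-sym I))) ΣΣmeet+2≡c[c+q])
    split-square : ∀ n q → suc n * n + suc n * suc q ≡ suc n * (suc n + q)
    split-square = solve-∀
    shuffle : ∀ x n q → 2 * x + suc n * suc q + 2 ≡ suc x * 2 + suc n * suc q
    shuffle = solve-∀
    pairs-count : ∀ x n → 2 * x + n * suc q + 2 ≡ n * (n + q) → n * (n ∸ 1) ≡ suc x * 2
    pairs-count x zero    eq = case trans (+-comm 2 _) eq of λ ()
    pairs-count x (suc n) eq = +-cancelʳ-≡ (suc n * suc q) _ _ (begin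
      suc n * n + suc n * suc q   ≡⟨ split-square n q ⟩
      suc n * (suc n + q)         ≡⟨ sym eq ⟩
      2 * x + suc n * suc q + 2   ≡⟨ shuffle x n q ⟩
      suc x * 2 + suc n * suc q   ∎)
      where open ≡-Reasoning

  ordered-meet≤1 : ∀ j j′ → j <ᶠ j′ → meet j j′ ≤ 1
  ordered-meet≤1 j j′ j<j′ = FloorOrCeil-n/1+n⇒≤1 {n = Σ< meet}
    (subst (FloorOrCeil (meet j j′) (Σ< meet)) pairs≡1+Σ<meet (meet-balanced j j′ j<j′))

  meet≤1 : ∀ j j′ → j ≢ j′ → meet j j′ ≤ 1
  meet≤1 j j′ j≢j′ with <-cmp j j′
  ... | tri< j<j′ _ _ = ordered-meet≤1 j j′ j<j′
  ... | tri≈ _ j≡j′ _ = ⊥-elim (j≢j′ j≡j′)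
  ... | tri> _ _ j′<j = subst (_≤ 1) (common-sym I j′ j) (ordered-meet≤1 j′ j j′<j)

  concurrence≤1 : ∀ s w → s ≢ w → concurrence s w ≤ 1
  concurrence≤1 = dual-common≤1 I I≤1 meet≤1

  -- The r columns through s carry r·q = v − 1 further symbols, each at most once.
  full⇒concurrence≡1 : ∀ {s} → degree I s ≡ suc q → ∀ w → s ≢ w → concurrence s w ≡ 1
  full⇒concurrence≡1 {s} full w s≢w =
    trans (Σ-tight concurrence≤spike (≤-reflexive Σspike≡Σconcurrence) w) (spike-off q s≢w)
    where
    concurrence≤spike : ∀ w → concurrence s w ≤ spike q s w
    concurrence≤spike = ≤spike (≤-reflexive (trans (common-self (flip I) (flip I≤1) s) full))
                               (concurrence≤1 s)
    square : ∀ q → suc (suc q * q) + q ≡ suc q * suc q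
    square = solve-∀
    Σspike≡Σconcurrence : Σ (spike q s) ≡ Σ (concurrence s)
    Σspike≡Σconcurrence = begin
      Σ (spike q s)                       ≡⟨ Σ-spike q s ⟩
      v + q                               ≡⟨ cong (_+ q) v≡2+c ⟩
      suc (suc c) + q                     ≡⟨ cong (λ x → suc x + q) 1+c≡[1+q]q ⟩
      suc (suc q * q) + q                 ≡⟨ square q ⟩
      suc q * suc q                       ≡⟨ cong (_* suc q) (sym full) ⟩
      degree I s * suc q                  ≡⟨ *-distribʳ-Σ (suc q) (I s) ⟩
      Σ (λ L → I s L * suc q)             ≡⟨ Σ-cong (λ L → cong (I s L *_) (sym (column-size L))) ⟩
      Σ (λ L → I s L * Σ (λ z → I z L))   ≡⟨ sym (Σ-common (flip I) s) ⟩
      Σ (concurrence s)                   ∎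
      where open ≡-Reasoning

  Σ-meet-through-full : ∀ {s j} → degree I s ≡ suc q → I s j ≡ 0 → Σ (λ L → I s L * meet L j) ≡ suc q
  Σ-meet-through-full {s} {j} full s∉j = begin
    Σ (λ L → I s L * meet L j)          ≡⟨ Σ-common-through I s j ⟩
    Σ (λ z → I z j * concurrence s z)   ≡⟨ Σ-cong joined ⟩
    Σ (λ z → I z j)                     ≡⟨ column-size j ⟩
    suc q                               ∎
    where
    open ≡-Reasoning
    joined : ∀ z → I z j * concurrence s z ≡ I z j
    joined z with s ≟ z
    ... | yes refl = trans (cong (_* concurrence s s) s∉j) (sym s∉j)
    ... | no s≢z   = trans (cong (I z j *_) (full⇒concurrence≡1 full z s≢z)) (*-identityʳ (I z j))

  -- Count the r symbols of j′ along the columns through s: j contributes none, the other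
  -- r − 1 columns at most one each.
  disjoint⇒degree≡q : ∀ {j j′ s} → meet j j′ ≡ 0 → I s j ≡ 1 → degree I s ≡ q
  disjoint⇒degree≡q {j} {j′} {s} j∩j′≡∅ s∈j with degree≡q⊎1+q s
  ... | inj₁ deg≡q = deg≡q
  ... | inj₂ full  = ⊥-elim (1+n≰n (begin
    suc (suc q)
      ≡⟨ cong₂ _+_ (sym (Σ-select j (λ _ → 1))) (sym (Σ-meet-through-full full s∉j′)) ⟩
    Σ (select j (λ _ → 1)) + Σ (λ L → I s L * meet L j′)
      ≡⟨ sym (Σ-distrib-+ (select j (λ _ → 1)) (λ L → I s L * meet L j′)) ⟩
    Σ (λ L → select j (λ _ → 1) L + I s L * meet L j′)
      ≤⟨ Σ-mono-≤ bounded ⟩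
    degree I s
      ≡⟨ full ⟩
    suc q
      ∎))
    where
    open ≤-Reasoning
    s∉j′ : I s j′ ≡ 0
    s∉j′ with m*n≡0⇒m≡0∨n≡0 (I s j)
                (n≤0⇒n≡0 (subst (I s j * I s j′ ≤_) j∩j′≡∅ (f[i]≤Σf (λ z → I z j * I z j′) s)))
    ... | inj₁ s∉j  = case trans (sym s∉j) s∈j of λ ()
    ... | inj₂ s∉j′ = s∉j′
    bounded : ∀ L → select j (λ _ → 1) L + I s L * meet L j′ ≤ I s L
    bounded L with j ≟ L | n≤1⇒n≡0∨n≡1 (I≤1 s L)
    ... | yes refl | _ = ≤-reflexive (trans (cong₂ (λ a m → suc (a * m)) s∈j j∩j′≡∅) (sym s∈j))
    ... | no _ | inj₁ s∉L rewrite s∉L = z≤n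
    ... | no _ | inj₂ s∈L rewrite s∈L =
      ≤-trans (≤-reflexive (+-identityʳ (meet L j′)))
              (meet≤1 L j′ λ { refl → case trans (sym s∈L) s∉j′ of λ () })

  deficit : Fin c → Fin c → ℕ
  deficit j L = spike q j L ∸ meet j L

  Σdeficit+Σmeet≡c+q : ∀ j → Σ (deficit j) + Σ (meet j) ≡ c + q
  Σdeficit+Σmeet≡c+q j = begin
    Σ (deficit j) + Σ (meet j)         ≡⟨ sym (Σ-distrib-+ (deficit j) (meet j)) ⟩
    Σ (λ L → deficit j L + meet j L)   ≡⟨ Σ-cong (λ L → m∸n+n≡m (meet≤spike L)) ⟩
    Σ (spike q j)                      ≡⟨ Σ-spike q j ⟩
    c + q                              ∎
    where
    open ≡-Reasoning
    meet≤spike : ∀ L → meet j L ≤ spike q j L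
    meet≤spike = ≤spike (≤-reflexive (meet-self j)) (meet≤1 j)

  ΣΣdeficit≡2 : Σ (λ j → Σ (deficit j)) ≡ 2
  ΣΣdeficit≡2 = +-cancelʳ-≡ ΣΣmeet _ _ (begin
    Σ (λ j → Σ (deficit j)) + ΣΣmeet       ≡⟨ sym (Σ-distrib-+ (λ j → Σ (deficit j)) (λ j → Σ (meet j))) ⟩
    Σ (λ j → Σ (deficit j) + Σ (meet j))   ≡⟨ Σ-cong Σdeficit+Σmeet≡c+q ⟩
    Σ {c} (λ _ → c + q)                    ≡⟨ Σ-const {c} (c + q) ⟩
    c * (c + q)                            ≡⟨ sym ΣΣmeet+2≡c[c+q] ⟩
    ΣΣmeet + 2                             ≡⟨ +-comm ΣΣmeet 2 ⟩
    2 + ΣΣmeet                             ∎)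
    where open ≡-Reasoning

  deficient⇒disjoint : ∀ {j j′} → deficit j j′ ≢ 0 → j ≢ j′ × meet j j′ ≡ 0
  deficient⇒disjoint {j} {j′} deficit≢0 =
    j≢j′ , n<1⇒n≡0 (subst (meet j j′ <_) (spike-off q j≢j′) (m∸n≢0⇒n<m deficit≢0))
    where
    j≢j′ : j ≢ j′
    j≢j′ refl = deficit≢0 (trans (cong₂ _∸_ (spike-self q j) (meet-self j)) (n∸n≡0 (suc q)))

  disjoint-pair : ∃₂ λ j j′ → j ≢ j′ × meet j j′ ≡ 0
  disjoint-pair with Σ≢0⇒∃≢0 (λ j → Σ (deficit j)) (λ ΣΣ≡0 → case trans (sym ΣΣdeficit≡2) ΣΣ≡0 of λ ())
  ... | j , Σdeficit≢0 with Σ≢0⇒∃≢0 (deficit j) Σdeficit≢0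
  ...   | j′ , deficit≢0 = j , j′ , deficient⇒disjoint deficit≢0

  disjoint⇒1+Σdeficit≡q : ∀ {j j′} → meet j j′ ≡ 0 → suc (Σ (deficit j)) ≡ q
  disjoint⇒1+Σdeficit≡q {j} {j′} j∩j′≡∅ = +-cancelʳ-≡ c _ _ (begin
    suc (Σ (deficit j)) + c      ≡⟨ sym (+-suc (Σ (deficit j)) c) ⟩
    Σ (deficit j) + suc c        ≡⟨ cong (Σ (deficit j) +_) (trans 1+c≡[1+q]q (sym Σmeet≡[1+q]q)) ⟩
    Σ (deficit j) + Σ (meet j)   ≡⟨ Σdeficit+Σmeet≡c+q j ⟩
    c + q                        ≡⟨ +-comm c q ⟩
    q + c                        ∎)
    where
    open ≡-Reasoning
    degree-on-j : ∀ z → I z j * degree I z ≡ I z j * q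
    degree-on-j z with n≤1⇒n≡0∨n≡1 (I≤1 z j)
    ... | inj₁ z∉j rewrite z∉j = refl
    ... | inj₂ z∈j = cong (I z j *_) (disjoint⇒degree≡q j∩j′≡∅ z∈j)
    Σmeet≡[1+q]q : Σ (meet j) ≡ suc q * q
    Σmeet≡[1+q]q = begin
      Σ (meet j)                     ≡⟨ Σ-common I j ⟩
      Σ (λ z → I z j * degree I z)   ≡⟨ Σ-cong degree-on-j ⟩
      Σ (λ z → I z j * q)            ≡⟨ sym (*-distribʳ-Σ q (λ z → I z j)) ⟩
      Σ (λ z → I z j) * q            ≡⟨ cong (_* q) (column-size j) ⟩
      suc q * q                      ∎

  disjoint⇒q≤2 : ∀ {j j′} → j ≢ j′ → meet j j′ ≡ 0 → q ≤ 2
  disjoint⇒q≤2 {j} {j′} j≢j′ j∩j′≡∅ =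
    halve (disjoint⇒1+Σdeficit≡q j∩j′≡∅)
          (disjoint⇒1+Σdeficit≡q (trans (common-sym I j′ j) j∩j′≡∅))
          (subst (Σ (deficit j) + Σ (deficit j′) ≤_) ΣΣdeficit≡2
                 (f[i]+f[j]≤Σf (λ k → Σ (deficit k)) j≢j′))
    where
    halve : ∀ {a b n} → suc a ≡ n → suc b ≡ n → a + b ≤ 2 → n ≤ 2
    halve {zero}        refl refl _                  = s≤s z≤n
    halve {suc zero}    refl refl _                  = s≤s (s≤s z≤n)
    halve {suc (suc a)} refl refl (s≤s (s≤s 2a+2≤0)) = case m+n≤o⇒n≤o a 2a+2≤0 of λ ()

  q≤2 : q ≤ 2
  q≤2 = let j , j′ , j≢j′ , j∩j′≡∅ = disjoint-pair in disjoint⇒q≤2 j≢j′ j∩j′≡∅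

χ : Bool → ℕ
χ b = if b then 1 else 0

χ≤1 : ∀ b → χ b ≤ 1
χ≤1 true  = s≤s z≤n
χ≤1 false = z≤n

∣p∩q∣≡Σ : ∀ {n} (p q : Subset n) → ∣ p ∩ q ∣ ≡ Σ λ s → χ (lookup p s) * χ (lookup q s)
∣p∩q∣≡Σ []          []          = refl
∣p∩q∣≡Σ (true  ∷ p) (true  ∷ q) = cong suc (∣p∩q∣≡Σ p q)
∣p∩q∣≡Σ (true  ∷ p) (false ∷ q) = ∣p∩q∣≡Σ p q
∣p∩q∣≡Σ (false ∷ p) (_     ∷ q) = ∣p∩q∣≡Σ p q

preimage-count : ∀ {m n} (g : Fin m → Fin n) → Injective _≡_ _≡_ g → ∀ y →
                 Σ (λ i → χ (does (g i ≟ y))) ≡ χ (does (any? λ i → g i ≟ y))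
preimage-count {zero}  g g-injective y = refl
preimage-count {suc m} g g-injective y with g fzero ≟ y
... | yes g₀≡y = cong suc (Σ-zero _ no-other-preimage)
  where
  no-other-preimage : ∀ i → χ (does (g (fsuc i) ≟ y)) ≡ 0
  no-other-preimage i with g (fsuc i) ≟ y
  ... | yes gᵢ≡y = case g-injective (trans g₀≡y (sym gᵢ≡y)) of λ ()
  ... | no _     = refl
... | no _ = preimage-count (g ∘ fsuc) (fsuc-injective ∘ g-injective) y

module _ {r c v : ℕ} (D : Design r c v) where

  incidence : Fin v → Fin c → ℕ
  incidence s j = χ (lookup (colSet D j) s)

  incidence≤1 : ∀ s j → incidence s j ≤ 1
  incidence≤1 s j = χ≤1 (lookup (colSet D j) s)

  columns-meet-balanced :
    (∀ j j′ → j <ᶠ j′ → FloorOrCeil ∣ colSet D j ∩ colSet D j′ ∣ (cc-total D) (pairs D c)) →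
    ∀ j j′ → j <ᶠ j′ → FloorOrCeil (common incidence j j′) (Σ< (common incidence)) (pairs D c)
  columns-meet-balanced balanced j j′ j<j′ =
    subst₂ (λ x a → FloorOrCeil x a (pairs D c))
           (∣p∩q∣≡Σ (colSet D j) (colSet D j′)) cc-total≡Σ<common (balanced j j′ j<j′)
    where
    cc-total≡Σ<common : cc-total D ≡ Σ< (common incidence)
    cc-total≡Σ<common = Σ-cong λ k → Σ-cong λ k′ →
      cong (λ x → if toℕ k <ᵇ toℕ k′ then x else 0) (∣p∩q∣≡Σ (colSet D k) (colSet D k′))

  module _ (columns-injective : ∀ j → Injective _≡_ _≡_ (λ i → D i j)) where

    incidence≡Σ : ∀ s j → incidence s j ≡ Σ (λ i → χ (does (D i j ≟ s)))
    incidence≡Σ s j = trans (cong χ (lookup∘tabulate _ s))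
                            (sym (preimage-count (λ i → D i j) (columns-injective j) s))

    column-size : ∀ j → Σ (λ s → incidence s j) ≡ r
    column-size j = begin
      Σ (λ s → incidence s j)                    ≡⟨ Σ-cong (λ s → incidence≡Σ s j) ⟩
      Σ (λ s → Σ (λ i → χ (does (D i j ≟ s))))   ≡⟨ Σ-comm (λ s i → χ (does (D i j ≟ s))) ⟩
      Σ (λ i → Σ (select (D i j) (λ _ → 1)))     ≡⟨ Σ-cong (λ i → Σ-select (D i j) (λ _ → 1)) ⟩
      Σ {r} (λ _ → 1)                            ≡⟨ trans (Σ-const {r} 1) (*-identityʳ r) ⟩
      r                                          ∎
      where open ≡-Reasoning

    degree-near-equireplicate : ∀ {m n} → EquiOrNearEqui D → ⌊ r * c / v ⌋ ≡ m → ⌈ r * c / v ⌉ ≡ n →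
                                ∀ s → degree incidence s ≡ m ⊎ degree incidence s ≡ n
    degree-near-equireplicate {m} {n} near-equi ⌊rc/v⌋≡m ⌈rc/v⌉≡n s =
      subst (λ x → x ≡ m ⊎ x ≡ n) occ≡degree
            (FloorOrCeil⇒≡⊎≡ {a = r * c} {b = v} (near-equi s) ⌊rc/v⌋≡m ⌈rc/v⌉≡n)
      where
      occ≡degree : occ D s ≡ degree incidence s
      occ≡degree = trans (Σ-comm (λ i j → χ (does (D i j ≟ s)))) (sym (Σ-cong (λ j → incidence≡Σ s j)))

theorem6p4 : (r : ℕ) → r ≥ 4 →
    (D : Design r (r * (r ∸ 1) ∸ 1) (r * (r ∸ 1) + 1)) → ¬ IsNearTripleArray D
theorem6p4 (suc q) (s≤s 3≤q) D ((_ , columns-injective) , near-equi , _ , _ , columns-balanced) =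
  <⇒≱ 3≤q (ColumnSystem.q≤2 q 1+c≡[1+q]q v≡2+c (incidence D) (incidence≤1 D)
             (column-size D columns-injective)
             (degree-near-equireplicate D columns-injective near-equi
               (proj₁ replication) (proj₂ replication))
             (columns-meet-balanced D columns-balanced))
  where
  instance
    q≢0 : NonZero q
    q≢0 = >-nonZero (<-≤-trans z<s 3≤q)
  1+c≡[1+q]q : suc (suc q * q ∸ 1) ≡ suc q * q
  1+c≡[1+q]q = suc-pred (suc q * q) {{m*n≢0 (suc q) q}}
  v≡2+c : suc q * q + 1 ≡ 2 + (suc q * q ∸ 1)
  v≡2+c = trans (+-comm (suc q * q) 1) (cong suc (sym 1+c≡[1+q]q))
  replication : ⌊ suc q * (suc q * q ∸ 1) / (suc q * q + 1) ⌋ ≡ q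
              × ⌈ suc q * (suc q * q ∸ 1) / (suc q * q + 1) ⌉ ≡ suc q
  replication = replication-number q (<⇒≤ 3≤q) 1+c≡[1+q]q v≡2+c
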